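{- Let $G$ be a connected maximal nontraceable graph of order $n\ge 6$, and suppose $v_1,v_2,v_3$ are vertices of degree $2$ in $G$ all having the same two neighbours $x_1$ and $x_2$. Then $G-\{v_1,v_2,v_3\}$ is complete, and hence $e(G)=\tfrac12(n^2-7n+24)$.
   Context: Graphs are simple and finite; $e(G)$ is the number of edges. A graph is traceable if it has a hamiltonian path. A graph $G$ is maximal nontraceable if $G$ is not traceable but $G+e$ is traceable for every pair of nonadjacent vertices joined by a new edge $e$. -}

module Defs where

open import Data.Nat using (ℕ; zero; suc; _+_; _<_; _<?_)
open import Data.Fin using (Fin; toℕ)
open import Data.Fin.Properties using (_≟_)
open import Data.Vec using (Vec; lookup)
open import Data.List using (List; length; filter; allFin; map)
open import Data.Nat.ListAction using (sum)
open import Data.Product using (Σ; ∃; _×_; _,_)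
open import Data.Sum using (_⊎_)
open import Data.Empty using (⊥)
open import Relation.Nullary using (¬_; Dec)
open import Relation.Nullary.Decidable using (_×-dec_)
open import Relation.Binary.PropositionalEquality using (_≡_)
open import Function using (Injective)

record Graph (n : ℕ) : Set₁ where
  field
    Adj   : Fin n → Fin n → Set
    adj?  : (x y : Fin n) → Dec (Adj x y)
    sym   : ∀ {x y} → Adj x y → Adj y x
    irrefl : ∀ {x} → ¬ Adj x x
open Graph public

-- Hamiltonian path: an ordering of all n vertices (injective map
-- Fin n → Fin n, i.e. a bijection) with consecutive vertices adjacent.
Consecutive : ∀ {n} → Fin n → Fin n → Set
Consecutive i j = suc (toℕ i) ≡ toℕ j

record HamPath {n : ℕ} (G : Graph n) : Set where
  field
    order     : Fin n → Fin n
    injective : Injective _≡_ _≡_ order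
    adjacent  : ∀ i j → Consecutive i j → Adj G (order i) (order j)

Traceable : ∀ {n} → Graph n → Set
Traceable G = HamPath G

_+edge_ : ∀ {n} → (G : Graph n) → Fin n × Fin n → Graph n
_+edge_ {n} G (u , v) = record
  { Adj = A
  ; adj? = dec
  ; sym = s
  ; irrefl = ir
  }
  where
  A : Fin n → Fin n → Set
  A x y = Adj G x y ⊎ ((x ≡ u × y ≡ v) ⊎ (x ≡ v × y ≡ u)) × ¬ (x ≡ y)
  open import Data.Sum using (inj₁; inj₂)
  open import Relation.Nullary using (yes; no)
  open import Relation.Nullary.Decidable using (_⊎-dec_; ¬?)
  open import Relation.Binary.PropositionalEquality using (refl)
  dec : (x y : Fin n) → Dec (A x y)
  dec x y = adj? G x y ⊎-dec (((x ≟ u ×-dec y ≟ v) ⊎-dec (x ≟ v ×-dec y ≟ u)) ×-dec ¬? (x ≟ y))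
  s : ∀ {x y} → A x y → A y x
  s (inj₁ a) = inj₁ (Graph.sym G a)
  s (inj₂ (inj₁ (p , q) , ne)) = inj₂ (inj₂ (q , p) , λ e → ne (Relation.Binary.PropositionalEquality.sym e))
  s (inj₂ (inj₂ (p , q) , ne)) = inj₂ (inj₁ (q , p) , λ e → ne (Relation.Binary.PropositionalEquality.sym e))
  ir : ∀ {x} → ¬ A x x
  ir (inj₁ a) = irrefl G a
  ir (inj₂ (_ , ne)) = ne refl

MaximalNontraceable : ∀ {n} → Graph n → Set
MaximalNontraceable {n} G =
  ¬ Traceable G ×
  (∀ (u v : Fin n) → ¬ u ≡ v → ¬ Adj G u v → Traceable (G +edge (u , v)))

data Reach {n} (G : Graph n) (x : Fin n) : Fin n → Set where
  here : Reach G x x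
  step : ∀ {y z} → Reach G x y → Adj G y z → Reach G x z

Connected : ∀ {n} → Graph n → Set
Connected {n} G = ∀ (x y : Fin n) → Reach G x y

neighbours : ∀ {n} → Graph n → Fin n → List (Fin n)
neighbours G v = filter (adj? G v) (allFin _)

degree : ∀ {n} → Graph n → Fin n → ℕ
degree G v = length (neighbours G v)

edgeCount : ∀ {n} → Graph n → ℕ
edgeCount {n} G =
  sum (map (λ i → length (filter (λ j → (toℕ i <? toℕ j) ×-dec adj? G i j) (allFin n))) (allFin n))

{-# OPTIONS --safe #-}

-- Along a hamiltonian path, a vertex with all its neighbours in {x₁, x₂} has its path-neighbours
-- in {x₁, x₂}. The middle one of v₁, v₂, v₃ is therefore flanked by x₁ and x₂, which forces the
-- three to sit at positions p, p + 2, p + 4; then the path-neighbour at p − 1 or at p + 5 (which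
-- exists as n ≠ 5) would be a third vertex of {x₁, x₂}. Adding an edge that avoids v₁, v₂, v₃
-- keeps this obstruction, so by maximality G − {v₁, v₂, v₃} is complete. The degrees are then
-- 2 on v₁, v₂, v₃, n − 1 on x₁, x₂ and n − 4 elsewhere, and the handshake lemma counts the edges.

module Submission where

open import Defs hiding (sym)
open import Data.Nat using (ℕ; zero; suc; _≤_; _<_; _<?_; _*_; _+_; _∸_; s≤s)
open import Data.Nat.Properties
  using (<-irrefl; <-cmp; m≢1+n+m; ≤-<-trans; <-trans; n<1+n; ≤∧≢⇒<; 1+n≰n; <⇒≢; m+n∸n≡m;
         +-assoc; +-identityʳ; *-comm; *-identityʳ; *-distribˡ-+; +-0-commutativeMonoid; +-*-semiring)
import Data.Nat.Properties as ℕ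
import Data.Nat.ListAction as List
open import Data.Nat.Tactic.RingSolver using (solve)
open import Data.Fin using (Fin; toℕ; fromℕ<; punchIn; punchOut)
open import Data.Fin.Properties
  using (_≟_; any?; toℕ<n; toℕ-fromℕ<; toℕ-injective; punchInᵢ≢i; punchOut-injective; injective⇒≤)
open import Data.List using (List; []; _∷_; [_]; length; filter; allFin; map; tabulate)
open import Data.List.Properties using (map-tabulate)
open import Data.List.Membership.Propositional using (_∈_; _∉_)
open import Data.List.Membership.Propositional.Properties using (∈-filter⁺; ∈-allFin)
open import Data.List.Relation.Unary.Any using (here; there)
open import Data.List.Relation.Unary.All using ([]; _∷_)
open import Data.List.Relation.Unary.All.Properties using (All¬⇒¬Any; ¬Any⇒All¬)
open import Data.List.Relation.Unary.AllPairs using ([]; _∷_)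
open import Data.List.Relation.Unary.Unique.Propositional using (Unique)
open import Data.Product using (∃; _×_; _,_; proj₁; proj₂)
open import Data.Sum using (_⊎_; inj₁; inj₂; [_,_]′)
open import Data.Empty using (⊥; ⊥-elim)
open import Function using (_∘_; id; flip)
open import Function.Definitions using (Injective)
open import Relation.Binary using (tri<; tri≈; tri>)
open import Relation.Binary.Definitions using (DecidableEquality)
open import Relation.Nullary using (¬_; Dec; yes; no; contradiction)
open import Relation.Nullary.Decidable using (_×-dec_; decidable-stable)
open import Relation.Unary using (Decidable)
open import Relation.Binary.PropositionalEquality
  using (_≡_; _≢_; refl; sym; trans; cong; cong₂; subst; ≢-sym; module ≡-Reasoning)
open import Algebra.Properties.CommutativeMonoid.Sum +-0-commutativeMonoid
  using (sum; sum-syntax; sum-cong-≗; sum-remove; sum-replicate-zero; ∑-distrib-+; ∑-comm)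
open import Algebra.Properties.Semiring.Sum +-*-semiring using (*-distribˡ-sum)
open ≡-Reasoning

AtMostTwo : {A : Set} → (A → Set) → Set
AtMostTwo P = ∀ {i j k} → P i → P j → P k → i ≢ j → i ≢ k → j ≢ k → ⊥

atMostTwo-∈-pair : {A : Set} {a b : A} → AtMostTwo (_∈ a ∷ b ∷ [])
atMostTwo-∈-pair (here refl)         (here refl)         _                   i≢j _   _   = i≢j refl
atMostTwo-∈-pair (there (here refl)) (there (here refl)) _                   i≢j _   _   = i≢j refl
atMostTwo-∈-pair (here refl)         _                   (here refl)         _   i≢k _   = i≢k refl
atMostTwo-∈-pair (there (here refl)) _                   (there (here refl)) _   i≢k _   = i≢k refl
atMostTwo-∈-pair _                   (here refl)         (here refl)         _   _   j≢k = j≢k refl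
atMostTwo-∈-pair _                   (there (here refl)) (there (here refl)) _   _   j≢k = j≢k refl

atMostTwo⇒⊆pair : {A : Set} {P : A → Set} {a b : A} → DecidableEquality A →
                  AtMostTwo P → P a → P b → a ≢ b → ∀ {y} → P y → y ∈ a ∷ b ∷ []
atMostTwo⇒⊆pair {a = a} {b} _≟_ two Pa Pb a≢b {y} Py with y ≟ a | y ≟ b
... | yes y≡a | _       = here y≡a
... | no _    | yes y≡b = there (here y≡b)
... | no y≢a  | no y≢b  = ⊥-elim (two Pa Pb Py a≢b (≢-sym y≢a) (≢-sym y≢b))

atMostTwo-fromSorted : {P : ℕ → Set} →
                       (∀ {i j k} → i < j → j < k → P i → P j → P k → ⊥) → AtMostTwo P
atMostTwo-fromSorted none {i} {j} {k} Pi Pj Pk i≢j i≢k j≢k with <-cmp i j | <-cmp j k | <-cmp i k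
... | tri≈ _ i≡j _ | _            | _            = i≢j i≡j
... | _            | tri≈ _ j≡k _ | _            = j≢k j≡k
... | _            | _            | tri≈ _ i≡k _ = i≢k i≡k
... | tri< i<j _ _ | tri< j<k _ _ | _            = none i<j j<k Pi Pj Pk
... | tri< i<j _ _ | tri> _ _ k<j | tri< i<k _ _ = none i<k k<j Pi Pk Pj
... | tri< i<j _ _ | tri> _ _ k<j | tri> _ _ k<i = none k<i i<j Pk Pi Pj
... | tri> _ _ j<i | tri< j<k _ _ | tri< i<k _ _ = none j<i i<k Pj Pi Pk
... | tri> _ _ j<i | tri< j<k _ _ | tri> _ _ k<i = none j<k k<i Pj Pk Pi
... | tri> _ _ j<i | tri> _ _ k<j | _            = none k<j j<i Pk Pj Pi

module PathPositions {n : ℕ} (n≢5 : n ≢ 5) {X V : ℕ → Set} (X-atMostTwo : AtMostTwo X)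
  (V-bounded : ∀ {p} → V p → p < n)
  (V-prev : ∀ {p} → V (suc p) → X p)
  (V-next : ∀ {p} → V p → suc p < n → X (suc p)) where

  private
    X-around : ∀ {q} → V (suc q) → suc (suc q) < n → ∀ {k} → X k → k ∈ q ∷ suc (suc q) ∷ []
    X-around V₂ 2+q<n = atMostTwo⇒⊆pair ℕ._≟_ X-atMostTwo (V-prev V₂) (V-next V₂ 2+q<n) (m≢1+n+m _)

    outermost : ∀ p → V p → V (4 + p) → (∀ {k} → X k → k ∈ suc p ∷ suc (suc (suc p)) ∷ []) → ⊥
    outermost zero _ V₄ around with around (V-next V₄ (≤∧≢⇒< (V-bounded V₄) (≢-sym n≢5)))
    ... | there (there ())
    outermost (suc s) V₁ _ around with around (V-prev V₁)
    ... | here s≡2+s = m≢1+n+m s s≡2+s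
    ... | there (here s≡4+s) = m≢1+n+m s s≡4+s

    sorted-absurd : ∀ {p₁ p₂ p₃} → p₁ < p₂ → p₂ < p₃ → V p₁ → V p₂ → V p₃ → ⊥
    sorted-absurd {p₁} {suc q} {suc r} (s≤s p₁≤q) (s≤s q<r) V₁ V₂ V₃
      with X-around V₂ (≤-<-trans (s≤s q<r) (V-bounded V₃))
    ... | around with around (V-prev V₃) | around (V-next V₁ (≤-<-trans (s≤s p₁≤q) (V-bounded V₂)))
    ...   | here refl         | _                 = <-irrefl refl q<r
    ...   | _                 | there (here refl) = <-irrefl refl p₁≤q
    ...   | there (here refl) | here refl         = outermost p₁ V₁ V₃ around

  atMostTwo : AtMostTwo V
  atMostTwo = atMostTwo-fromSorted sorted-absurd

injective⇒surjective : ∀ {n} {f : Fin n → Fin n} → Injective _≡_ _≡_ f → ∀ y → ∃ λ i → f i ≡ y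
injective⇒surjective {suc m} {f} f-injective y with any? (λ i → f i ≟ y)
... | yes hit = hit
... | no miss = ⊥-elim (1+n≰n (injective⇒≤ g-injective))
  where
  g : Fin (suc m) → Fin m
  g i = punchOut {i = y} λ y≡fi → miss (i , sym y≡fi)
  g-injective : Injective _≡_ _≡_ g
  g-injective = f-injective ∘ punchOut-injective {i = y} _ _

NeighboursWithin : ∀ {n} → Graph n → (Fin n → Set) → (Fin n → Set) → Set
NeighboursWithin G V X = ∀ {v y} → V v → Adj G v y → X y

module _ {n : ℕ} {G : Graph n} (path : HamPath G) where
  open HamPath path

  Positions : (Fin n → Set) → ℕ → Set
  Positions P p = ∃ λ i → toℕ i ≡ p × P (order i)

  Positions-atMostTwo : ∀ {P} → AtMostTwo P → AtMostTwo (Positions P)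
  Positions-atMostTwo two (i , refl , Pi) (j , refl , Pj) (k , refl , Pk) i≢j i≢k j≢k =
    two Pi Pj Pk (i≢j ∘ distinct) (i≢k ∘ distinct) (j≢k ∘ distinct)
    where
    distinct : ∀ {i j} → order i ≡ order j → toℕ i ≡ toℕ j
    distinct = cong toℕ ∘ injective

  Positions-atMostTwo⁻ : ∀ {P} → AtMostTwo (Positions P) → AtMostTwo P
  Positions-atMostTwo⁻ two {a} {b} {c} Pa Pb Pc a≢b a≢c b≢c
    with injective⇒surjective injective a | injective⇒surjective injective b
       | injective⇒surjective injective c
  ... | i , refl | j , refl | k , refl =
    two (i , refl , Pa) (j , refl , Pb) (k , refl , Pc) (a≢b ∘ same) (a≢c ∘ same) (b≢c ∘ same)
    where
    same : ∀ {i j} → toℕ i ≡ toℕ j → order i ≡ order j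
    same = cong order ∘ toℕ-injective

  Positions-bounded : ∀ {P p} → Positions P p → p < n
  Positions-bounded (i , refl , _) = toℕ<n i

  module _ {V X : Fin n → Set} (nbrs : NeighboursWithin G V X) where

    Positions-next : ∀ {p} → Positions V p → suc p < n → Positions X (suc p)
    Positions-next (i , refl , Vi) 1+p<n =
      j , toℕ-fromℕ< 1+p<n , nbrs Vi (adjacent i j (sym (toℕ-fromℕ< 1+p<n)))
      where
      j : Fin n
      j = fromℕ< 1+p<n

    Positions-prev : ∀ {p} → Positions V (suc p) → Positions X p
    Positions-prev {p} (i , i≡1+p , Vi) =
      j , toℕ-fromℕ< p<n , nbrs Vi (Graph.sym G (adjacent j i j-precedes-i))
      where
      p<n : p < n
      p<n = <-trans (n<1+n p) (subst (_< n) i≡1+p (toℕ<n i))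
      j : Fin n
      j = fromℕ< p<n
      j-precedes-i : Consecutive j i
      j-precedes-i = trans (cong suc (toℕ-fromℕ< p<n)) (sym i≡1+p)

traceable⇒atMostTwo : ∀ {n} {G : Graph n} {V X : Fin n → Set} → n ≢ 5 →
                      AtMostTwo X → NeighboursWithin G V X → Traceable G → AtMostTwo V
traceable⇒atMostTwo {V = V} {X} n≢5 X-atMostTwo nbrs path =
  Positions-atMostTwo⁻ path
    (PathPositions.atMostTwo n≢5 {Positions path X} {Positions path V}
      (Positions-atMostTwo path X-atMostTwo)
      (Positions-bounded path {V}) (Positions-prev path nbrs) (Positions-next path nbrs))

+edge-neighboursWithin : ∀ {n} {G : Graph n} {V X : Fin n → Set} {x y} → ¬ V x → ¬ V y →
                         NeighboursWithin G V X → NeighboursWithin (G +edge (x , y)) V X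
+edge-neighboursWithin _   _   nbrs Vv (inj₁ v~z)                   = nbrs Vv v~z
+edge-neighboursWithin ¬Vx _   _    Vv (inj₂ (inj₁ (refl , _) , _)) = ⊥-elim (¬Vx Vv)
+edge-neighboursWithin _   ¬Vy _    Vv (inj₂ (inj₂ (refl , _) , _)) = ⊥-elim (¬Vy Vv)

maximalNontraceable⇒complete : ∀ {n} {G : Graph n} {V X : Fin n → Set} → n ≢ 5 →
  MaximalNontraceable G → AtMostTwo X → NeighboursWithin G V X → ¬ AtMostTwo V →
  ∀ x y → x ≢ y → ¬ V x → ¬ V y → Adj G x y
maximalNontraceable⇒complete {G = G} {V} {X} n≢5 (_ , maximal) X-atMostTwo nbrs manyV
                             x y x≢y ¬Vx ¬Vy =
  decidable-stable (adj? G x y) λ x≁y →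
    manyV (traceable⇒atMostTwo {V = V} {X} n≢5 X-atMostTwo nbrs+xy (maximal x y x≢y x≁y))
  where
  nbrs+xy : NeighboursWithin (G +edge (x , y)) V X
  nbrs+xy = +edge-neighboursWithin {G = G} {x = x} {y} ¬Vx ¬Vy nbrs

degree≡2⇒atMostTwo : ∀ {n} {G : Graph n} {v} → degree G v ≡ 2 → AtMostTwo (Adj G v)
degree≡2⇒atMostTwo {G = G} {v} deg v~i v~j v~k =
  length≡2⇒atMostTwo deg (listed v~i) (listed v~j) (listed v~k)
  where
  listed : ∀ {y} → Adj G v y → y ∈ neighbours G v
  listed = ∈-filter⁺ (adj? G v) (∈-allFin _)
  length≡2⇒atMostTwo : ∀ {A : Set} {xs : List A} → length xs ≡ 2 → AtMostTwo (_∈ xs)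
  length≡2⇒atMostTwo {xs = _ ∷ _ ∷ []} refl = atMostTwo-∈-pair

⟦_⟧ : {P : Set} → Dec P → ℕ
⟦ yes _ ⟧ = 1
⟦ no _ ⟧ = 0

⟦⟧-yes : {P : Set} (P? : Dec P) → P → ⟦ P? ⟧ ≡ 1
⟦⟧-yes (yes _) _ = refl
⟦⟧-yes (no ¬p) p = contradiction p ¬p

⟦⟧-no : {P : Set} (P? : Dec P) → ¬ P → ⟦ P? ⟧ ≡ 0
⟦⟧-no (yes p) ¬p = contradiction p ¬p
⟦⟧-no (no _)  _  = refl

⟦⟧-cong : {P Q : Set} (P? : Dec P) (Q? : Dec Q) → (P → Q) → (Q → P) → ⟦ P? ⟧ ≡ ⟦ Q? ⟧
⟦⟧-cong (yes p) Q? p→q _ = sym (⟦⟧-yes Q? (p→q p))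
⟦⟧-cong (no ¬p) Q? _ q→p = sym (⟦⟧-no Q? (¬p ∘ q→p))

count : ∀ {n} {P : Fin n → Set} → Decidable P → ℕ
count {n} P? = ∑[ j < n ] ⟦ P? j ⟧

∑-const : ∀ n c → ∑[ i < n ] c ≡ n * c
∑-const zero    c = refl
∑-const (suc n) c = cong (c +_) (∑-const n c)

∑-+-* : ∀ {n} (f : Fin n → ℕ) c (g : Fin n → ℕ) → ∑[ i < n ] (f i + c * g i) ≡ sum f + c * sum g
∑-+-* f c g = trans (∑-distrib-+ f (λ i → c * g i)) (cong (sum f +_) (sym (*-distribˡ-sum c g)))

sum-map-allFin : ∀ {n} (f : Fin n → ℕ) → List.sum (map f (allFin n)) ≡ sum f
sum-map-allFin f = trans (cong List.sum (map-tabulate id f)) (sum-tabulate f)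
  where
  sum-tabulate : ∀ {n} (f : Fin n → ℕ) → List.sum (tabulate f) ≡ sum f
  sum-tabulate {zero}  f = refl
  sum-tabulate {suc n} f = cong (f Fin.zero +_) (sum-tabulate (f ∘ Fin.suc))

length-filter-allFin : ∀ {n} {P : Fin n → Set} (P? : Decidable P) →
                       length (filter P? (allFin n)) ≡ count P?
length-filter-allFin {n} P? = trans (length-filter (allFin n)) (sum-map-allFin (⟦_⟧ ∘ P?))
  where
  length-filter : ∀ xs → length (filter P? xs) ≡ List.sum (map (⟦_⟧ ∘ P?) xs)
  length-filter []       = refl
  length-filter (x ∷ xs) with P? x
  ... | yes _ = cong suc (length-filter xs)
  ... | no _  = length-filter xs

count-≟ : ∀ {n} (a : Fin n) → count (_≟ a) ≡ 1
count-≟ {suc n} a = begin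
  count (_≟ a)                               ≡⟨ sum-remove {i = a} (λ j → ⟦ j ≟ a ⟧) ⟩
  ⟦ a ≟ a ⟧ + ∑[ k < n ] ⟦ punchIn a k ≟ a ⟧  ≡⟨ cong₂ _+_ (⟦⟧-yes (a ≟ a) refl) others ⟩
  1                                          ∎
  where
  others : ∑[ k < n ] ⟦ punchIn a k ≟ a ⟧ ≡ 0
  others = trans (sum-cong-≗ λ k → ⟦⟧-no (punchIn a k ≟ a) (punchInᵢ≢i a k)) (sum-replicate-zero n)

count-complement : ∀ {n} {P Q : Fin n → Set} (P? : Decidable P) (Q? : Decidable Q) →
                   (∀ j → P j ⊎ Q j) → (∀ j → P j → ¬ Q j) → count P? + count Q? ≡ n
count-complement {n} P? Q? cover disjoint = begin
  count P? + count Q?              ≡⟨ sym (∑-distrib-+ (⟦_⟧ ∘ P?) (⟦_⟧ ∘ Q?)) ⟩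
  ∑[ j < n ] (⟦ P? j ⟧ + ⟦ Q? j ⟧) ≡⟨ sum-cong-≗ exactlyOne ⟩
  ∑[ j < n ] 1                     ≡⟨ ∑-const n 1 ⟩
  n * 1                            ≡⟨ *-identityʳ n ⟩
  n                                ∎
  where
  exactlyOne : ∀ j → ⟦ P? j ⟧ + ⟦ Q? j ⟧ ≡ 1
  exactlyOne j with P? j | Q? j
  ... | yes p | yes q = contradiction q (disjoint j p)
  ... | yes _ | no _  = refl
  ... | no _  | yes _ = refl
  ... | no ¬p | no ¬q = ⊥-elim ([ ¬p , ¬q ]′ (cover j))

handshake : ∀ {n} (G : Graph n) → 2 * edgeCount G ≡ ∑[ i < n ] degree G i
handshake {n} G = begin
  2 * edgeCount G                                  ≡⟨ cong (2 *_) edges ⟩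
  2 * E                                            ≡⟨ cong (E +_) (+-identityʳ E) ⟩
  E + E                                            ≡⟨ cong (E +_) (∑-comm L) ⟩
  E + ∑[ i < n ] ∑[ j < n ] L j i                  ≡⟨ sym (∑-distrib-+ (sum ∘ L) (λ i → ∑[ j < n ] L j i)) ⟩
  ∑[ i < n ] (∑[ j < n ] L i j + ∑[ j < n ] L j i) ≡⟨ sum-cong-≗ (λ i → sym (∑-distrib-+ (L i) (λ j → L j i))) ⟩
  ∑[ i < n ] ∑[ j < n ] (L i j + L j i)            ≡⟨ sum-cong-≗ (sum-cong-≗ ∘ forwardOrBackward) ⟩
  ∑[ i < n ] count (adj? G i)                      ≡⟨ sum-cong-≗ (sym ∘ length-filter-allFin ∘ adj? G) ⟩
  ∑[ i < n ] degree G i                            ∎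
  where
  forward? : ∀ i j → Dec (toℕ i < toℕ j × Adj G i j)
  forward? i j = (toℕ i <? toℕ j) ×-dec adj? G i j
  L : Fin n → Fin n → ℕ
  L i j = ⟦ forward? i j ⟧
  E : ℕ
  E = ∑[ i < n ] ∑[ j < n ] L i j
  edges : edgeCount G ≡ E
  edges = trans (sum-map-allFin (λ i → length (filter (forward? i) (allFin n))))
                (sum-cong-≗ (length-filter-allFin ∘ forward?))
  forwardOrBackward : ∀ i j → L i j + L j i ≡ ⟦ adj? G i j ⟧
  forwardOrBackward i j with <-cmp (toℕ i) (toℕ j)
  ... | tri< i<j _ j≮i = begin
    L i j + L j i       ≡⟨ cong₂ _+_ (⟦⟧-cong (forward? i j) (adj? G i j) proj₂ (i<j ,_))
                                     (⟦⟧-no (forward? j i) (j≮i ∘ proj₁)) ⟩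
    ⟦ adj? G i j ⟧ + 0  ≡⟨ +-identityʳ _ ⟩
    ⟦ adj? G i j ⟧      ∎
  ... | tri≈ i≮j i≡j j≮i = begin
    L i j + L j i       ≡⟨ cong₂ _+_ (⟦⟧-no (forward? i j) (i≮j ∘ proj₁))
                                     (⟦⟧-no (forward? j i) (j≮i ∘ proj₁)) ⟩
    0                   ≡⟨ sym (⟦⟧-no (adj? G i j) (irrefl G ∘ subst (Adj G i) (sym (toℕ-injective i≡j)))) ⟩
    ⟦ adj? G i j ⟧      ∎
  ... | tri> i≮j _ j<i =
    cong₂ _+_ (⟦⟧-no (forward? i j) (i≮j ∘ proj₁))
              (⟦⟧-cong (forward? j i) (adj? G i j) (Graph.sym G ∘ proj₂) ((j<i ,_) ∘ Graph.sym G))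

-- The three vertex classes, weighted by their indicators v and x, with the degree equations
-- arranged so that no truncated subtraction occurs.
classIdentity : ∀ {n d v x} →
  (d ≡ 2 × v ≡ 1 × x ≡ 0) ⊎ (d + 1 ≡ n × v ≡ 0 × x ≡ 1) ⊎ (d + 4 ≡ n × v ≡ 0 × x ≡ 0) →
  d + 4 + n * v ≡ n + 6 * v + 3 * x
classIdentity {n}     (inj₁ (refl , refl , refl))        = solve [ n ]
classIdentity {d = d} (inj₂ (inj₁ (refl , refl , refl))) = solve [ d ]
classIdentity {d = d} (inj₂ (inj₂ (refl , refl , refl))) = solve [ d ]

module _ {n : ℕ} where
  open import Data.List.Membership.DecPropositional (_≟_ {n}) using (_∈?_)

  count-∈ : ∀ {xs : List (Fin n)} → Unique xs → count (_∈? xs) ≡ length xs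
  count-∈ [] = sum-replicate-zero n
  count-∈ {x ∷ xs} (x∉xs ∷ xs-unique) = begin
    count (_∈? x ∷ xs)                   ≡⟨ sum-cong-≗ split ⟩
    ∑[ j < n ] (⟦ j ≟ x ⟧ + ⟦ j ∈? xs ⟧) ≡⟨ ∑-distrib-+ (λ j → ⟦ j ≟ x ⟧) (λ j → ⟦ j ∈? xs ⟧) ⟩
    count (_≟ x) + count (_∈? xs)        ≡⟨ cong₂ _+_ (count-≟ x) (count-∈ xs-unique) ⟩
    suc (length xs)                      ∎
    where
    split : ∀ j → ⟦ j ∈? x ∷ xs ⟧ ≡ ⟦ j ≟ x ⟧ + ⟦ j ∈? xs ⟧
    split j with j ≟ x
    ... | yes refl = cong suc (sym (⟦⟧-no (j ∈? xs) (All¬⇒¬Any x∉xs)))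
    ... | no j≢x   = ⟦⟧-cong _ (j ∈? xs) drop-x there
      where
      drop-x : j ∈ x ∷ xs → j ∈ xs
      drop-x (here j≡x)   = contradiction j≡x j≢x
      drop-x (there j∈xs) = j∈xs

  degree-complement : ∀ {G : Graph n} {u} {xs : List (Fin n)} → Unique xs →
                      (∀ j → Adj G u j ⊎ j ∈ xs) → (∀ j → Adj G u j → j ∉ xs) →
                      degree G u + length xs ≡ n
  degree-complement {G} {u} {xs} xs-unique cover disjoint = begin
    degree G u + length xs              ≡⟨ cong₂ _+_ (length-filter-allFin (adj? G u))
                                                     (sym (count-∈ xs-unique)) ⟩
    count (adj? G u) + count (_∈? xs)   ≡⟨ count-complement (adj? G u) (_∈? xs) cover disjoint ⟩
    n                                   ∎

  module _ (d : Fin n → ℕ) {vs xs : List (Fin n)} (vs-unique : Unique vs) (xs-unique : Unique xs)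
    (|vs|≡3 : length vs ≡ 3) (|xs|≡2 : length xs ≡ 2) (disjoint : ∀ {i} → i ∈ vs → i ∉ xs)
    (d-vs : ∀ {i} → i ∈ vs → d i ≡ 2) (d-xs : ∀ {i} → i ∈ xs → d i + 1 ≡ n)
    (d-rest : ∀ {i} → i ∉ vs → i ∉ xs → d i + 4 ≡ n) where

    private
      V X : Fin n → ℕ
      V i = ⟦ i ∈? vs ⟧
      X i = ⟦ i ∈? xs ⟧

      ∑V : ∑[ i < n ] V i ≡ 3
      ∑V = trans (count-∈ vs-unique) |vs|≡3

      ∑X : ∑[ i < n ] X i ≡ 2
      ∑X = trans (count-∈ xs-unique) |xs|≡2

      pointwise : ∀ i → d i + 4 + n * V i ≡ n + 6 * V i + 3 * X i
      pointwise i with i ∈? vs | i ∈? xs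
      ... | yes i∈vs | yes i∈xs = contradiction i∈xs (disjoint i∈vs)
      ... | yes i∈vs | no _     = classIdentity (inj₁ (d-vs i∈vs , refl , refl))
      ... | no _     | yes i∈xs = classIdentity (inj₂ (inj₁ (d-xs i∈xs , refl , refl)))
      ... | no i∉vs  | no i∉xs  = classIdentity (inj₂ (inj₂ (d-rest i∉vs i∉xs , refl , refl)))

      ∑-lhs : ∑[ i < n ] (d i + 4 + n * V i) ≡ sum d + n * 4 + n * 3
      ∑-lhs = begin
        ∑[ i < n ] (d i + 4 + n * V i)   ≡⟨ ∑-+-* (λ i → d i + 4) n V ⟩
        ∑[ i < n ] (d i + 4) + n * sum V ≡⟨ cong₂ _+_ (∑-distrib-+ d (λ _ → 4)) (cong (n *_) ∑V) ⟩
        sum d + ∑[ i < n ] 4 + n * 3     ≡⟨ cong (λ a → sum d + a + n * 3) (∑-const n 4) ⟩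
        sum d + n * 4 + n * 3            ∎

      ∑-rhs : ∑[ i < n ] (n + 6 * V i + 3 * X i) ≡ n * n + 6 * 3 + 3 * 2
      ∑-rhs = begin
        ∑[ i < n ] (n + 6 * V i + 3 * X i)   ≡⟨ ∑-+-* (λ i → n + 6 * V i) 3 X ⟩
        ∑[ i < n ] (n + 6 * V i) + 3 * sum X ≡⟨ cong₂ _+_ (∑-+-* (λ _ → n) 6 V) (cong (3 *_) ∑X) ⟩
        ∑[ i < n ] n + 6 * sum V + 3 * 2     ≡⟨ cong₂ (λ a b → a + 6 * b + 3 * 2) (∑-const n n) ∑V ⟩
        n * n + 6 * 3 + 3 * 2                ∎

    ∑-byClasses : sum d + 7 * n ≡ n * n + 24
    ∑-byClasses = begin
      sum d + 7 * n                      ≡⟨ cong (sum d +_) (trans (*-comm 7 n) (*-distribˡ-+ n 4 3)) ⟩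
      sum d + (n * 4 + n * 3)            ≡⟨ sym (+-assoc (sum d) (n * 4) (n * 3)) ⟩
      sum d + n * 4 + n * 3              ≡⟨ sym ∑-lhs ⟩
      ∑[ i < n ] (d i + 4 + n * V i)     ≡⟨ sum-cong-≗ pointwise ⟩
      ∑[ i < n ] (n + 6 * V i + 3 * X i) ≡⟨ ∑-rhs ⟩
      n * n + 6 * 3 + 3 * 2              ≡⟨ +-assoc (n * n) 18 6 ⟩
      n * n + 24                         ∎

module DegreeTwoTriple {n : ℕ} (n≢5 : n ≢ 5) {G : Graph n} (mnt : MaximalNontraceable G)
  {v₁ v₂ v₃ x₁ x₂ : Fin n} (v₁≢v₂ : v₁ ≢ v₂) (v₁≢v₃ : v₁ ≢ v₃) (v₂≢v₃ : v₂ ≢ v₃) (x₁≢x₂ : x₁ ≢ x₂)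
  (attached : ∀ {v} → v ∈ v₁ ∷ v₂ ∷ v₃ ∷ [] → degree G v ≡ 2 × Adj G v x₁ × Adj G v x₂) where

  open import Data.List.Membership.DecPropositional (_≟_ {n}) using (_∈?_)

  vs xs : List (Fin n)
  vs = v₁ ∷ v₂ ∷ v₃ ∷ []
  xs = x₁ ∷ x₂ ∷ []

  vs-unique : Unique vs
  vs-unique = (v₁≢v₂ ∷ v₁≢v₃ ∷ []) ∷ (v₂≢v₃ ∷ []) ∷ [] ∷ []

  xs-unique : Unique xs
  xs-unique = (x₁≢x₂ ∷ []) ∷ [] ∷ []

  vs-¬atMostTwo : ¬ AtMostTwo (_∈ vs)
  vs-¬atMostTwo two =
    two (here refl) (there (here refl)) (there (there (here refl))) v₁≢v₂ v₁≢v₃ v₂≢v₃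

  adj-xs : ∀ {v x} → v ∈ vs → x ∈ xs → Adj G v x
  adj-xs v∈vs (here refl)         = proj₁ (proj₂ (attached v∈vs))
  adj-xs v∈vs (there (here refl)) = proj₂ (proj₂ (attached v∈vs))

  vs-disjoint-xs : ∀ {i} → i ∈ vs → i ∉ xs
  vs-disjoint-xs i∈vs i∈xs = irrefl G (adj-xs i∈vs i∈xs)

  neighboursWithin : NeighboursWithin G (_∈ vs) (_∈ xs)
  neighboursWithin v∈vs =
    atMostTwo⇒⊆pair _≟_ (degree≡2⇒atMostTwo {G = G} (proj₁ (attached v∈vs)))
      (adj-xs v∈vs (here refl)) (adj-xs v∈vs (there (here refl))) x₁≢x₂

  complete : ∀ x y → x ≢ y → x ∉ vs → y ∉ vs → Adj G x y
  complete = maximalNontraceable⇒complete n≢5 mnt atMostTwo-∈-pair neighboursWithin vs-¬atMostTwo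

  degree-xs : ∀ {x} → x ∈ xs → degree G x + 1 ≡ n
  degree-xs {x} x∈xs = degree-complement {G = G} {x} ([] ∷ []) cover disjoint
    where
    cover : ∀ j → Adj G x j ⊎ j ∈ x ∷ []
    cover j with j ≟ x | j ∈? vs
    ... | yes j≡x | _       = inj₂ (here j≡x)
    ... | no _    | yes j∈vs = inj₁ (Graph.sym G (adj-xs j∈vs x∈xs))
    ... | no j≢x  | no j∉vs  = inj₁ (complete x j (j≢x ∘ sym) (flip vs-disjoint-xs x∈xs) j∉vs)
    disjoint : ∀ j → Adj G x j → j ∉ x ∷ []
    disjoint j x~j (here refl) = irrefl G x~j

  degree-rest : ∀ {w} → w ∉ vs → w ∉ xs → degree G w + 4 ≡ n
  degree-rest {w} w∉vs w∉xs =
    degree-complement {G = G} {w} (¬Any⇒All¬ vs w∉vs ∷ vs-unique) cover disjoint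
    where
    cover : ∀ j → Adj G w j ⊎ j ∈ w ∷ vs
    cover j with j ≟ w | j ∈? vs
    ... | yes j≡w | _        = inj₂ (here j≡w)
    ... | no _    | yes j∈vs = inj₂ (there j∈vs)
    ... | no j≢w  | no j∉vs  = inj₁ (complete w j (j≢w ∘ sym) w∉vs j∉vs)
    disjoint : ∀ j → Adj G w j → j ∉ w ∷ vs
    disjoint j w~j (here refl)  = irrefl G w~j
    disjoint j w~j (there j∈vs) = w∉xs (neighboursWithin j∈vs (Graph.sym G w~j))

  edgeCount-formula : 2 * edgeCount G ≡ n * n + 24 ∸ 7 * n
  edgeCount-formula = begin
    2 * edgeCount G                       ≡⟨ handshake G ⟩
    ∑[ i < n ] degree G i                 ≡⟨ sym (m+n∸n≡m _ (7 * n)) ⟩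
    ∑[ i < n ] degree G i + 7 * n ∸ 7 * n ≡⟨ cong (_∸ 7 * n) degreeSum ⟩
    n * n + 24 ∸ 7 * n                    ∎
    where
    degreeSum : ∑[ i < n ] degree G i + 7 * n ≡ n * n + 24
    degreeSum = ∑-byClasses (degree G) vs-unique xs-unique refl refl vs-disjoint-xs
                  (proj₁ ∘ attached) degree-xs degree-rest

lemma7 : (n : ℕ) → 6 ≤ n → (G : Graph n) →
    Connected G → MaximalNontraceable G →
    (v₁ v₂ v₃ x₁ x₂ : Fin n) →
    ¬ v₁ ≡ v₂ → ¬ v₁ ≡ v₃ → ¬ v₂ ≡ v₃ → ¬ x₁ ≡ x₂ →
    degree G v₁ ≡ 2 → degree G v₂ ≡ 2 → degree G v₃ ≡ 2 →
    Adj G v₁ x₁ → Adj G v₁ x₂ →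
    Adj G v₂ x₁ → Adj G v₂ x₂ →
    Adj G v₃ x₁ → Adj G v₃ x₂ →
    (∀ (x y : Fin n) → ¬ x ≡ y →
       ¬ x ≡ v₁ → ¬ x ≡ v₂ → ¬ x ≡ v₃ →
       ¬ y ≡ v₁ → ¬ y ≡ v₂ → ¬ y ≡ v₃ → Adj G x y)
    × (2 * edgeCount G ≡ n * n + 24 ∸ 7 * n)
lemma7 n 6≤n G _ mnt v₁ v₂ v₃ x₁ x₂ v₁≢v₂ v₁≢v₃ v₂≢v₃ x₁≢x₂ d₁ d₂ d₃ a₁₁ a₁₂ a₂₁ a₂₂ a₃₁ a₃₂ =
  (λ x y x≢y x≢v₁ x≢v₂ x≢v₃ y≢v₁ y≢v₂ y≢v₃ →
     complete x y x≢y (All¬⇒¬Any (x≢v₁ ∷ x≢v₂ ∷ x≢v₃ ∷ []))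
                      (All¬⇒¬Any (y≢v₁ ∷ y≢v₂ ∷ y≢v₃ ∷ []))) ,
  edgeCount-formula
  where
  attached : ∀ {v} → v ∈ v₁ ∷ v₂ ∷ v₃ ∷ [] → degree G v ≡ 2 × Adj G v x₁ × Adj G v x₂
  attached (here refl)                 = d₁ , a₁₁ , a₁₂
  attached (there (here refl))         = d₂ , a₂₁ , a₂₂
  attached (there (there (here refl))) = d₃ , a₃₁ , a₃₂
  open DegreeTwoTriple (≢-sym (<⇒≢ 6≤n)) mnt v₁≢v₂ v₁≢v₃ v₂≢v₃ x₁≢x₂ attached
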